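{- On the graph $\overline{\mathcal{DS}}(n)$, we have (1) $Q_{V^{*}}(x_1,x_j) = 2(j-1)$ for $j>1$; (2) $Q_{V^{*}}(x_2,x_j) = 2(j-2)(j-1)$ for $j>2$; (3) $Q_{V^{*}}(x_2,x_j) = Q_{V^{*}}(x_2,x_{j-1}) + Q_{V^{*}}(x_1,x_{j-1}) + Q_{V^{*}}(x_1,x_{j})-2$ for $j>2$.
   Context: Setting: Let $AD(n)$ be the Aztec diamond of order $n$ with the checkerboard coloring in which the unit squares along its top right side are black. Mark the midpoint of the left edge of each black unit square and join these midpoints by edges, giving a subgraph of the triangular lattice whose edges are oriented southeast, northeast and east (steps $(1,0),(0,1),(1,1)$, i.e. Delannoy paths). Let $\mathcal{DS}(n)$ be the "left half" of this graph (on or to the left of the vertical diagonal of $AD(n)$). Label the midpoints on the vertical diagonal by $v_2,v_4,\dots,v_{2n}$ from bottom to top and those one unit to the left of the vertical diagonal by $v_1,v_3,\dots,v_{2n-1}$ from bottom to top; $V=\{v_1,\dots,v_{2n}\}$. The graph $\overline{\mathcal{DS}}(n)$ is obtained from $\mathcal{DS}(n)$ by adding edges (oriented southeast) between consecutive points of its southwestern boundary; these boundary points are labeled $x_1,\dots,x_n$ from bottom to top. All edge weights are $1$. Writing $N(a,v)$ for the number of paths from $a$ to $v$ in $\overline{\mathcal{DS}}(n)$, one has $N(x_i,v_\ell)=d_{\lfloor (2i-\ell)/2\rfloor,\lfloor \ell/2\rfloor}$ for $1\le \ell\le 2i$ (and $0$ otherwise), where $d_{p,q}=\sum_{r=0}^{p}\binom{p}{r}\binom{q}{r}2^r$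 is the Delannoy number. Define $$Q_{V^{*}}(a,b)=\sum_{1\le m\le n}\det\begin{bmatrix} N(a,v_{2m-1}) & N(a,v_{2m})\\ N(b,v_{2m-1}) & N(b,v_{2m})\end{bmatrix}.$$ -}

module Defs where

open import Data.Nat as ℕ using (ℕ; zero; suc; _∸_; _/_; _≤ᵇ_)
open import Data.Nat.Combinatorics using (_C_)
open import Data.Bool using (if_then_else_)
open import Data.Integer as ℤ using (ℤ; +_)

-- Finite sum  Σ_{r=a}^{b} f r  over naturals (empty if b < a)
sumFromTo : ℕ → ℕ → (ℕ → ℕ) → ℕ
sumFromTo a b f = go (suc b ∸ a)
  where
  go : ℕ → ℕ
  go zero    = 0
  go (suc k) = f (a ℕ.+ k) ℕ.+ go k

sumZ : ℕ → ℕ → (ℕ → ℤ) → ℤ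
sumZ a b f = go (suc b ∸ a)
  where
  go : ℕ → ℤ
  go zero    = + 0
  go (suc k) = f (a ℕ.+ k) ℤ.+ go k

delannoy : ℕ → ℕ → ℕ
delannoy p q = sumFromTo 0 p (λ r → (p C r) ℕ.* (q C r) ℕ.* (2 ℕ.^ r))

N : ℕ → ℕ → ℕ
N i ℓ = if (1 ≤ᵇ ℓ) Data.Bool.∧ (ℓ ≤ᵇ 2 ℕ.* i)
        then delannoy ((2 ℕ.* i ∸ ℓ) / 2) (ℓ / 2)
        else 0

Q : ℕ → ℕ → ℕ → ℤ
Q n a b = sumZ 1 n (λ m →
  (+ N a (2 ℕ.* m ∸ 1)) ℤ.* (+ N b (2 ℕ.* m))
  ℤ.- (+ N a (2 ℕ.* m)) ℤ.* (+ N b (2 ℕ.* m ∸ 1)))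

{-# OPTIONS --safe #-}
module Submission where

-- N(x_a, v_ℓ) vanishes for ℓ > 2a, so only the determinants with m ≤ a contribute to
-- Q_{V*}(x_a, x_b): one for a = 1 and two for a = 2.  Their entries are Delannoy numbers
-- d_{p,q} with q ≤ 2, and since C(q,r) = 0 for r > q these are
-- d_{p,0} = 1, d_{p,1} = 1 + 2p and d_{p,2} = 1 + 2p(p+1).  Each determinant is then an
-- explicit polynomial in b, and (3) is a polynomial identity between (1) and (2).

open import Defs
open import Data.Nat as ℕ using (ℕ; zero; suc; _<_; _≤_; _∸_; _/_; z≤n; s≤s)
open import Data.Nat.Properties
  using (≤⇒≤ᵇ; ≤ᵇ⇒≤; <⇒≱; ≤-total; ≤-trans; ≤-pred; m≤n⇒m<n∨m≡n; m≤m+n; m+n∸m≡n;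
         *-suc; *-zeroʳ; *-comm; *-monoʳ-≤; *-monoʳ-<; ∸-monoˡ-≤)
open import Data.Nat.DivMod using (m*n/n≡m; +-distrib-/-∣ʳ)
open import Data.Nat.Divisibility using (m∣m*n)
open import Data.Nat.Combinatorics using (_C_; k>n⇒nCk≡0; nC1≡n; nCk+nC[k+1]≡[n+1]C[k+1])
import Data.Nat.Tactic.RingSolver as ℕ-Solver
open import Data.Integer using (ℤ; +_; _+_; _-_; _*_)
open import Data.Integer.Properties using (+-identityˡ; +-identityʳ; pos-*)
import Data.Integer.Tactic.RingSolver as ℤ-Solver
open import Data.Bool using (true; false)
open import Data.Bool.Properties using (T-≡; ¬-not; ∧-zeroʳ)
open import Data.List using (_∷_; [])
open import Data.Product using (_×_; _,_)
open import Data.Sum using (inj₁; inj₂)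
open import Function using (_∘_)
open import Function.Bundles using (Equivalence)
open import Relation.Binary.PropositionalEquality
  using (_≡_; refl; sym; trans; cong; cong₂; subst; module ≡-Reasoning)

open ≡-Reasoning

≤ᵇ-true : ∀ {m n} → m ≤ n → (m ℕ.≤ᵇ n) ≡ true
≤ᵇ-true = Equivalence.to T-≡ ∘ ≤⇒≤ᵇ

≤ᵇ-false : ∀ {m n} → n < m → (m ℕ.≤ᵇ n) ≡ false
≤ᵇ-false {m} {n} n<m = ¬-not (<⇒≱ n<m ∘ ≤ᵇ⇒≤ m n ∘ Equivalence.from T-≡)

sumFromTo-stable : ∀ f {q} → (∀ {r} → q < r → f r ≡ 0) →
                   ∀ {p} → q ≤ p → sumFromTo 0 p f ≡ sumFromTo 0 q f
sumFromTo-stable f vanish {zero}  z≤n = refl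
sumFromTo-stable f vanish {suc p} q≤1+p with m≤n⇒m<n∨m≡n q≤1+p
... | inj₂ refl    = refl
... | inj₁ q<1+p = trans (cong (ℕ._+ sumFromTo 0 p f) (vanish q<1+p))
                         (sumFromTo-stable f vanish (≤-pred q<1+p))

sumZ-stable : ∀ f {a} → (∀ {m} → a < m → f m ≡ + 0) →
              ∀ {n} → a ≤ n → sumZ 1 n f ≡ sumZ 1 a f
sumZ-stable f vanish {zero}  z≤n = refl
sumZ-stable f {a} vanish {suc n} a≤1+n with m≤n⇒m<n∨m≡n a≤1+n
... | inj₂ refl    = refl
... | inj₁ a<1+n = begin
  f (suc n) + sumZ 1 n f ≡⟨ cong (_+ sumZ 1 n f) (vanish a<1+n) ⟩
  + 0 + sumZ 1 n f       ≡⟨ +-identityˡ _ ⟩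
  sumZ 1 n f             ≡⟨ sumZ-stable f vanish (≤-pred a<1+n) ⟩
  sumZ 1 a f             ∎

delannoy-truncate : ∀ p q → delannoy p q ≡ sumFromTo 0 q (λ r → (p C r) ℕ.* (q C r) ℕ.* 2 ℕ.^ r)
delannoy-truncate p q with ≤-total q p
... | inj₁ q≤p = sumFromTo-stable _ vanish q≤p
  where
  vanish : ∀ {r} → q < r → (p C r) ℕ.* (q C r) ℕ.* 2 ℕ.^ r ≡ 0
  vanish {r} q<r rewrite k>n⇒nCk≡0 q<r | *-zeroʳ (p C r) = refl
... | inj₂ p≤q = sym (sumFromTo-stable _ vanish p≤q)
  where
  vanish : ∀ {r} → p < r → (p C r) ℕ.* (q C r) ℕ.* 2 ℕ.^ r ≡ 0
  vanish {r} p<r rewrite k>n⇒nCk≡0 p<r = refl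

2*nC2+n≡n*n : ∀ n → 2 ℕ.* (n C 2) ℕ.+ n ≡ n ℕ.* n
2*nC2+n≡n*n zero    = refl
2*nC2+n≡n*n (suc n) = begin
  2 ℕ.* (suc n C 2) ℕ.+ suc n
    ≡⟨ cong (λ c → 2 ℕ.* c ℕ.+ suc n) (sym (nCk+nC[k+1]≡[n+1]C[k+1] n 1)) ⟩
  2 ℕ.* (n C 1 ℕ.+ n C 2) ℕ.+ suc n
    ≡⟨ cong (λ c → 2 ℕ.* (c ℕ.+ n C 2) ℕ.+ suc n) (nC1≡n n) ⟩
  2 ℕ.* (n ℕ.+ n C 2) ℕ.+ suc n
    ≡⟨ regroup n (n C 2) ⟩
  (2 ℕ.* (n C 2) ℕ.+ n) ℕ.+ 2 ℕ.* n ℕ.+ 1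
    ≡⟨ cong (λ s → s ℕ.+ 2 ℕ.* n ℕ.+ 1) (2*nC2+n≡n*n n) ⟩
  n ℕ.* n ℕ.+ 2 ℕ.* n ℕ.+ 1
    ≡⟨ square n ⟩
  suc n ℕ.* suc n ∎
  where
  regroup : ∀ n c → 2 ℕ.* (n ℕ.+ c) ℕ.+ suc n ≡ (2 ℕ.* c ℕ.+ n) ℕ.+ 2 ℕ.* n ℕ.+ 1
  regroup = ℕ-Solver.solve-∀
  square : ∀ n → n ℕ.* n ℕ.+ 2 ℕ.* n ℕ.+ 1 ≡ suc n ℕ.* suc n
  square = ℕ-Solver.solve-∀

delannoy-zeroʳ : ∀ p → delannoy p 0 ≡ 1
delannoy-zeroʳ p = delannoy-truncate p 0

delannoy-oneʳ : ∀ p → delannoy p 1 ≡ 1 ℕ.+ 2 ℕ.* p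
delannoy-oneʳ p = begin
  delannoy p 1                   ≡⟨ delannoy-truncate p 1 ⟩
  (p C 1) ℕ.* 1 ℕ.* 2 ℕ.+ 1      ≡⟨ cong (λ c → c ℕ.* 1 ℕ.* 2 ℕ.+ 1) (nC1≡n p) ⟩
  p ℕ.* 1 ℕ.* 2 ℕ.+ 1            ≡⟨ ℕ-Solver.solve (p ∷ []) ⟩
  1 ℕ.+ 2 ℕ.* p                  ∎

delannoy-twoʳ : ∀ p → delannoy p 2 ≡ 1 ℕ.+ 2 ℕ.* p ℕ.* suc p
delannoy-twoʳ p = begin
  delannoy p 2
    ≡⟨ delannoy-truncate p 2 ⟩
  (p C 2) ℕ.* 1 ℕ.* 4 ℕ.+ ((p C 1) ℕ.* 2 ℕ.* 2 ℕ.+ 1)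
    ≡⟨ cong (λ c → (p C 2) ℕ.* 1 ℕ.* 4 ℕ.+ (c ℕ.* 2 ℕ.* 2 ℕ.+ 1)) (nC1≡n p) ⟩
  (p C 2) ℕ.* 1 ℕ.* 4 ℕ.+ (p ℕ.* 2 ℕ.* 2 ℕ.+ 1)
    ≡⟨ regroup p (p C 2) ⟩
  2 ℕ.* (2 ℕ.* (p C 2) ℕ.+ p) ℕ.+ 2 ℕ.* p ℕ.+ 1
    ≡⟨ cong (λ s → 2 ℕ.* s ℕ.+ 2 ℕ.* p ℕ.+ 1) (2*nC2+n≡n*n p) ⟩
  2 ℕ.* (p ℕ.* p) ℕ.+ 2 ℕ.* p ℕ.+ 1
    ≡⟨ ℕ-Solver.solve (p ∷ []) ⟩
  1 ℕ.+ 2 ℕ.* p ℕ.* suc p ∎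
  where
  regroup : ∀ p c → c ℕ.* 1 ℕ.* 4 ℕ.+ (p ℕ.* 2 ℕ.* 2 ℕ.+ 1) ≡
                    2 ℕ.* (2 ℕ.* c ℕ.+ p) ℕ.+ 2 ℕ.* p ℕ.+ 1
  regroup = ℕ-Solver.solve-∀

2*n/2≡n : ∀ n → 2 ℕ.* n / 2 ≡ n
2*n/2≡n n = trans (cong (_/ 2) (*-comm 2 n)) (m*n/n≡m n 2)

[1+2*n]/2≡n : ∀ n → suc (2 ℕ.* n) / 2 ≡ n
[1+2*n]/2≡n n = trans (+-distrib-/-∣ʳ 1 {2 ℕ.* n} {2} (m∣m*n n)) (2*n/2≡n n)

N-inside : ∀ {a ℓ} → 1 ≤ ℓ → ℓ ≤ 2 ℕ.* a → N a ℓ ≡ delannoy ((2 ℕ.* a ∸ ℓ) / 2) (ℓ / 2)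
N-inside 1≤ℓ ℓ≤2a rewrite ≤ᵇ-true 1≤ℓ | ≤ᵇ-true ℓ≤2a = refl

N-outside : ∀ {a ℓ} → 2 ℕ.* a < ℓ → N a ℓ ≡ 0
N-outside {a} {ℓ} 2a<ℓ rewrite ≤ᵇ-false 2a<ℓ | ∧-zeroʳ (1 ℕ.≤ᵇ ℓ) = refl

N-split : ∀ {a ℓ} k → 1 ≤ ℓ → 2 ℕ.* a ≡ ℓ ℕ.+ k → N a ℓ ≡ delannoy (k / 2) (ℓ / 2)
N-split {a} {ℓ} k 1≤ℓ 2a≡ℓ+k = begin
  N a ℓ
    ≡⟨ N-inside {a} 1≤ℓ (subst (ℓ ≤_) (sym 2a≡ℓ+k) (m≤m+n ℓ k)) ⟩
  delannoy ((2 ℕ.* a ∸ ℓ) / 2) (ℓ / 2)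
    ≡⟨ cong (λ x → delannoy ((x ∸ ℓ) / 2) (ℓ / 2)) 2a≡ℓ+k ⟩
  delannoy ((ℓ ℕ.+ k ∸ ℓ) / 2) (ℓ / 2)
    ≡⟨ cong (λ x → delannoy (x / 2) (ℓ / 2)) (m+n∸m≡n ℓ k) ⟩
  delannoy (k / 2) (ℓ / 2) ∎

N-even : ∀ m p → N (suc m ℕ.+ p) (2 ℕ.* suc m) ≡ delannoy p (suc m)
N-even m p =
  trans (N-split {suc m ℕ.+ p} {2 ℕ.* suc m} (2 ℕ.* p) (s≤s z≤n) (ℕ-Solver.solve (m ∷ p ∷ [])))
        (cong₂ delannoy (2*n/2≡n p) (2*n/2≡n (suc m)))

N-odd : ∀ m p → N (suc m ℕ.+ p) (suc (2 ℕ.* m)) ≡ delannoy p m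
N-odd m p =
  trans (N-split {suc m ℕ.+ p} {suc (2 ℕ.* m)} (suc (2 ℕ.* p)) (s≤s z≤n)
                 (ℕ-Solver.solve (m ∷ p ∷ [])))
        (cong₂ delannoy ([1+2*n]/2≡n p) ([1+2*n]/2≡n m))

Q-stable : ∀ {n a} b → a ≤ n → Q n a b ≡ Q a a b
Q-stable {n} {a} b a≤n = sumZ-stable _ vanish a≤n
  where
  2a<2m-1 : ∀ {m} → a < m → 2 ℕ.* a < 2 ℕ.* m ∸ 1
  2a<2m-1 {m} a<m = ∸-monoˡ-≤ 1 (subst (_≤ 2 ℕ.* m) (*-suc 2 a) (*-monoʳ-≤ 2 a<m))
  vanish : ∀ {m} → a < m →
           + N a (2 ℕ.* m ∸ 1) * + N b (2 ℕ.* m) - + N a (2 ℕ.* m) * + N b (2 ℕ.* m ∸ 1) ≡ + 0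
  vanish a<m rewrite N-outside {a} (2a<2m-1 a<m) | N-outside {a} (*-monoʳ-< 2 a<m) = refl

pos-det : ∀ a b c d {e} → a ℕ.* d ≡ b ℕ.* c ℕ.+ e → + a * + d - + b * + c ≡ + e
pos-det a b c d {e} ad≡bc+e = begin
  + a * + d - + b * + c           ≡⟨ cong₂ _-_ (sym (pos-* a d)) (sym (pos-* b c)) ⟩
  + (a ℕ.* d) - + (b ℕ.* c)       ≡⟨ cong (λ x → + x - + (b ℕ.* c)) ad≡bc+e ⟩
  + (b ℕ.* c) + + e - + (b ℕ.* c) ≡⟨ x+y-x≡y (+ (b ℕ.* c)) (+ e) ⟩
  + e                             ∎
  where
  x+y-x≡y : ∀ (x y : ℤ) → x + y - x ≡ y
  x+y-x≡y = ℤ-Solver.solve-∀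

Q₁-closed-form : ∀ {n} p → 1 ≤ n → Q n 1 (suc p) ≡ + 2 * + p
Q₁-closed-form {n} p 1≤n = begin
  Q n 1 (suc p)      ≡⟨ Q-stable (suc p) 1≤n ⟩
  Q 1 1 (suc p)      ≡⟨ cong (_+ + 0) (pos-det 1 1 (N (suc p) 1) (N (suc p) 2) det₁) ⟩
  + (2 ℕ.* p) + + 0  ≡⟨ +-identityʳ _ ⟩
  + (2 ℕ.* p)        ≡⟨ pos-* 2 p ⟩
  + 2 * + p          ∎
  where
  det₁ : 1 ℕ.* N (suc p) 2 ≡ 1 ℕ.* N (suc p) 1 ℕ.+ 2 ℕ.* p
  det₁ rewrite N-even 0 p | N-odd 0 p | delannoy-oneʳ p | delannoy-zeroʳ p = ℕ-Solver.solve (p ∷ [])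

Q₂-closed-form : ∀ {n} p → 2 ≤ n → Q n 2 (2 ℕ.+ p) ≡ + 2 * + p * + suc p
Q₂-closed-form {n} p 2≤n = begin
  Q n 2 (2 ℕ.+ p)
    ≡⟨ Q-stable (2 ℕ.+ p) 2≤n ⟩
  Q 2 2 (2 ℕ.+ p)
    ≡⟨ cong₂ (λ x y → x + (y + + 0)) (pos-det 1 1 (N (2 ℕ.+ p) 3) (N (2 ℕ.+ p) 4) det₂)
                                      (pos-det 1 3 (N (2 ℕ.+ p) 1) (N (2 ℕ.+ p) 2) det₁) ⟩
  + (2 ℕ.* p ℕ.* p) + (+ (2 ℕ.* p) + + 0)
    ≡⟨ cong (λ y → + (2 ℕ.* p ℕ.* p) + y) (+-identityʳ (+ (2 ℕ.* p))) ⟩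
  + (2 ℕ.* p ℕ.* p ℕ.+ 2 ℕ.* p)
    ≡⟨ cong +_ (ℕ-Solver.solve (p ∷ [])) ⟩
  + (2 ℕ.* p ℕ.* suc p)
    ≡⟨ pos-* (2 ℕ.* p) (suc p) ⟩
  + (2 ℕ.* p) * + suc p
    ≡⟨ cong (_* + suc p) (pos-* 2 p) ⟩
  + 2 * + p * + suc p ∎
  where
  det₁ : 1 ℕ.* N (2 ℕ.+ p) 2 ≡ 3 ℕ.* N (2 ℕ.+ p) 1 ℕ.+ 2 ℕ.* p
  det₁ rewrite N-even 0 (suc p) | N-odd 0 (suc p) | delannoy-oneʳ (suc p) | delannoy-zeroʳ (suc p) =
    ℕ-Solver.solve (p ∷ [])
  det₂ : 1 ℕ.* N (2 ℕ.+ p) 4 ≡ 1 ℕ.* N (2 ℕ.+ p) 3 ℕ.+ 2 ℕ.* p ℕ.* p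
  det₂ rewrite N-even 1 p | N-odd 1 p | delannoy-twoʳ p | delannoy-oneʳ p = ℕ-Solver.solve (p ∷ [])

Q₂-recurrence : ∀ {n} t → 2 ≤ n →
                  Q n 2 (3 ℕ.+ t) ≡ Q n 2 (2 ℕ.+ t) + Q n 1 (2 ℕ.+ t) + Q n 1 (3 ℕ.+ t) - + 2
Q₂-recurrence {n} t 2≤n = begin
  Q n 2 (3 ℕ.+ t)
    ≡⟨ Q₂-closed-form (suc t) 2≤n ⟩
  + 2 * + suc t * + suc (suc t)
    ≡⟨ polynomial-identity (+ t) ⟩
  + 2 * + t * + suc t + + 2 * + suc t + + 2 * + suc (suc t) - + 2
    ≡⟨ cong₂ (λ x y → x + y + + 2 * + suc (suc t) - + 2)
             (Q₂-closed-form t 2≤n) (Q₁-closed-form (suc t) 1≤n) ⟨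
  Q n 2 (2 ℕ.+ t) + Q n 1 (2 ℕ.+ t) + + 2 * + suc (suc t) - + 2
    ≡⟨ cong (λ z → Q n 2 (2 ℕ.+ t) + Q n 1 (2 ℕ.+ t) + z - + 2) (Q₁-closed-form (suc (suc t)) 1≤n) ⟨
  Q n 2 (2 ℕ.+ t) + Q n 1 (2 ℕ.+ t) + Q n 1 (3 ℕ.+ t) - + 2 ∎
  where
  polynomial-identity : ∀ (x : ℤ) → + 2 * (+ 1 + x) * (+ 2 + x) ≡
                        + 2 * x * (+ 1 + x) + + 2 * (+ 1 + x) + + 2 * (+ 2 + x) - + 2
  polynomial-identity = ℤ-Solver.solve-∀
  1≤n : 1 ≤ n
  1≤n = ≤-trans (s≤s z≤n) 2≤n

lemma4p2 : (n : ℕ) →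
    ((j : ℕ) → 1 < j → j ≤ n → Q n 1 j ≡ + 2 * + (j ∸ 1))
    × ((j : ℕ) → 2 < j → j ≤ n → Q n 2 j ≡ + 2 * + (j ∸ 2) * + (j ∸ 1))
    × ((j : ℕ) → 2 < j → j ≤ n →
         Q n 2 j ≡ Q n 2 (j ∸ 1) + Q n 1 (j ∸ 1) + Q n 1 j - + 2)
lemma4p2 n = closed₁ , closed₂ , recurrence
  where
  closed₁ : (j : ℕ) → 1 < j → j ≤ n → Q n 1 j ≡ + 2 * + (j ∸ 1)
  closed₁ (suc p) (s≤s _) j≤n = Q₁-closed-form p (≤-trans (s≤s z≤n) j≤n)

  closed₂ : (j : ℕ) → 2 < j → j ≤ n → Q n 2 j ≡ + 2 * + (j ∸ 2) * + (j ∸ 1)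
  closed₂ (suc (suc p)) (s≤s (s≤s _)) j≤n = Q₂-closed-form p (≤-trans (s≤s (s≤s z≤n)) j≤n)

  recurrence : (j : ℕ) → 2 < j → j ≤ n → Q n 2 j ≡ Q n 2 (j ∸ 1) + Q n 1 (j ∸ 1) + Q n 1 j - + 2
  recurrence (suc (suc (suc t))) (s≤s (s≤s (s≤s _))) j≤n =
    Q₂-recurrence t (≤-trans (s≤s (s≤s z≤n)) j≤n)
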